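{- Every strong Euler–Gauss sequence is a Gauss sequence, i.e. satisfies $\sum_{d\mid n}\mu(d)a_{n/d}\equiv0\pmod n$ for all $n\ge1$.
   Context: $\mu$ is the Möbius function. For an integer sequence $(a_n)$ let $A_n^+=\prod_{d\mid n,\ \mu(d)=1} a_{n/d}$ and $A_n^-=\prod_{d\mid n,\ \mu(d)=-1} a_{n/d}$ (empty products equal $1$). $(a_n)$ is a strong Euler–Gauss sequence if for every $n\ge1$ the integers $A_n^+/\gcd(A_n^+,A_n^-)$ and $A_n^-/\gcd(A_n^+,A_n^-)$ are invertible modulo $n$ and $\left(\frac{A_n^- }{\gcd(A_n^+,A_n^-)}\right)^{ -1}\equiv\left(\frac{A_n^+}{\gcd(A_n^+,A_n^-)}\right)^{ -1}\pmod n$. -}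

module Defs where

open import Data.Nat as ℕ using (ℕ; zero; suc; _/_)
open import Data.Nat.Divisibility as ℕD using (_∣?_)
open import Data.Nat.Primality using (prime?)
open import Data.Integer as ℤ using (ℤ; +_; -_; -1ℤ; 0ℤ; 1ℤ)
open import Data.Integer.Divisibility as ℤD using ()
open import Data.Integer.GCD as ℤG using ()
open import Data.List using (List; filter; map; upTo; foldr; length)
open import Data.Bool.ListAction using (any)
open import Data.Bool using (if_then_else_)
open import Data.Product using (_×_; Σ; ∃; ∃-syntax; _,_)
open import Relation.Nullary using (¬_; does)
open import Relation.Nullary.Decidable using (_×-dec_)
open import Relation.Binary.PropositionalEquality using (_≡_; _≢_)

-- integer sequences are indexed by n ≥ 1; the value at index 0 is ignored
Seq : Set
Seq = ℕ → ℤ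

prodℤ : List ℤ → ℤ
prodℤ = foldr ℤ._*_ 1ℤ

sumℤ : List ℤ → ℤ
sumℤ = foldr ℤ._+_ 0ℤ

ω : ℕ → ℕ
ω n = length (filter (λ p → prime? p ×-dec (p ∣? n)) (upTo (suc n)))

hasSquareFactor : ℕ → Data.Bool.Bool
hasSquareFactor n = any (λ k → does ((suc (suc k) ℕ.* suc (suc k)) ∣? n)) (upTo n)

μ : ℕ → ℤ
μ d = if hasSquareFactor d then 0ℤ else (-1ℤ ℤ.^ ω d)

-- the divisors of n ≥ 1, listed as k with d = suc k ∣ n
divisorsPred : ℕ → List ℕ
divisorsPred n = filter (λ k → suc k ∣? n) (upTo n)

A⁺ : Seq → ℕ → ℤ
A⁺ a n = prodℤ (map (λ k → a (n / suc k))
                    (filter (λ k → μ (suc k) ℤ.≟ 1ℤ) (divisorsPred n)))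

A⁻ : Seq → ℕ → ℤ
A⁻ a n = prodℤ (map (λ k → a (n / suc k))
                    (filter (λ k → μ (suc k) ℤ.≟ -1ℤ) (divisorsPred n)))

_≡_[mod_] : ℤ → ℤ → ℕ → Set
x ≡ y [mod n ] = (+ n) ℤD.∣ (x ℤ.- y)

IsInverseMod : ℤ → ℤ → ℕ → Set
IsInverseMod x u n = (x ℤ.* u) ≡ 1ℤ [mod n ]

-- strong Euler–Gauss sequence: for every n ≥ 1, with g = gcd(A⁺_n, A⁻_n)
-- (which must be nonzero so that the quotients are defined), the quotients
-- P = A⁺_n / g and M = A⁻_n / g are invertible mod n and M⁻¹ ≡ P⁻¹ (mod n).
StrongEulerGauss : Seq → Set
StrongEulerGauss a =
  ∀ n → 1 ℕ.≤ n →
    let g = ℤG.gcd (A⁺ a n) (A⁻ a n) in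
    g ≢ 0ℤ ×
    Σ ℤ λ P → Σ ℤ λ M →
      (P ℤ.* g ≡ A⁺ a n) × (M ℤ.* g ≡ A⁻ a n) ×
      Σ ℤ λ P⁻¹ → Σ ℤ λ M⁻¹ →
        IsInverseMod P P⁻¹ n × IsInverseMod M M⁻¹ n × (M⁻¹ ≡ P⁻¹ [mod n ])

Gauss : Seq → Set
Gauss a = ∀ n → 1 ℕ.≤ n →
  sumℤ (map (λ k → μ (suc k) ℤ.* a (n / suc k)) (divisorsPred n)) ≡ 0ℤ [mod n ]

{-# OPTIONS --safe #-}
-- Fix a prime p and write n = q m with q = p^(j+1) and p ∤ m. The divisors of n with μ ≠ 0
-- are the squarefree d ∣ m and the p d, with μ (p d) = - μ d, so the Gauss sum at n equals
-- Σ_{d ∣ m} μ d (a (n / d) - a (n / (p d))), which is ≡ 0 (mod q) as soon as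
-- a (q m′) ≡ a (p^j m′) (mod q) for every m′ ∣ m. The strong Euler–Gauss condition says that
-- u A⁺_n = v A⁻_n for some units u ≡ v (mod n). Call x and y associated (x ≃ y ⟨mod n ⟩)
-- when u x = v y for such units: unlike congruence, this survives cancelling a nonzero
-- common factor. Splitting A⁺_n and A⁻_n along d ↦ p d and cancelling the factors with
-- d > 1, associated by induction on m, associates a (q m) with a (p^j m), and associated
-- numbers are congruent. Since every prime power dividing n divides the Gauss sum, so does n.
module Submission where

open import Algebra.Core using (Op₂)
open import Algebra.Structures using (IsCommutativeMonoid)
open import Data.Bool using (true; false; T)
open import Data.Empty using (⊥-elim)
open import Data.Integer as ℤ using (ℤ; +_; -_; 0ℤ; 1ℤ; -1ℤ)
import Data.Integer.Divisibility.Signed as ℤ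
import Data.Integer.Properties as ℤ
open import Data.Integer.Tactic.RingSolver using (solve-∀)
open import Data.List using (List; []; _∷_; _++_; map; filter; foldr; upTo)
import Data.List.Properties as List
open import Data.List.Membership.Propositional using (_∈_; lose)
open import Data.List.Membership.Propositional.Properties
  using (∈-filter⁺; ∈-filter⁻; ∈-upTo⁺; ∈-map⁺; ∈-map⁻; ∈-++⁺ˡ; ∈-++⁺ʳ; ∈-++⁻)
open import Data.List.Membership.Propositional.Properties.WithK using (unique∧set⇒bag)
open import Data.List.Relation.Binary.BagAndSetEquality using (∼bag⇒↭)
open import Data.List.Relation.Binary.Permutation.Propositional using (_↭_; ↭⇒↭ₛ)
import Data.List.Relation.Binary.Permutation.Propositional.Properties as ↭
open import Data.List.Relation.Unary.All as All using (All; []; _∷_)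
open import Data.List.Relation.Unary.Any using (here; there; satisfied)
open import Data.List.Relation.Unary.Any.Properties using (any⁺; any⁻)
open import Data.List.Relation.Unary.Unique.Propositional using (Unique; _∷_)
import Data.List.Relation.Unary.Unique.Propositional.Properties as Unique
open import Data.Nat as ℕ using (ℕ; zero; suc; _<_; _≤_; _/_; NonZero)
open import Data.Nat.Coprimality as Coprime using (Coprime; coprime-divisor; coprime⇒gcd≡1)
open import Data.Nat.DivMod using (*-/-assoc; m*n/m*o≡n/o; n/1≡n; m/n<m; /-congˡ)
open import Data.Nat.Divisibility as ℕ
  using (_∣_; _∣?_; divides; ∣-trans; ∣⇒≤; m∣m*n; n∣m*n; ∣n⇒∣m*n; _∣0; 1∣_; ∣1⇒≡1; 0∣⇒≡0;
         m/n∣m; *-monoʳ-∣; *-monoˡ-∣; *-cancelˡ-∣; *-pres-∣)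
open import Data.Nat.Induction using (<-rec)
open import Data.Nat.LCM using (lcm; lcm-least; gcd*lcm)
open import Data.Nat.Primality
  using (Prime; prime?; euclidsLemma; prime⇒nonZero; prime⇒nonTrivial; prime⇒irreducible; ¬prime[1])
open import Data.Nat.Primality.Factorisation using (factorise)
import Data.Nat.Properties as ℕ
open import Data.Product using (∃-syntax; ∃₂; _×_; _,_; proj₂)
open import Data.Sum using (_⊎_; inj₁; inj₂; [_,_])
open import Data.Unit using (tt)
open import Function using (_∘_; id)
open import Function.Bundles using (_⇔_; mk⇔; Equivalence)
open import Relation.Binary.Bundles using (Setoid)
open import Relation.Binary.PropositionalEquality
  using (_≡_; _≢_; refl; sym; trans; cong; cong₂; subst; subst₂; setoid; module ≡-Reasoning)
import Relation.Binary.Reasoning.Setoid as SetoidReasoning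
open import Relation.Nullary using (¬_; Dec; yes; no; does; contradiction)
open import Relation.Nullary.Decidable using (_×-dec_)

open import Data.List.Relation.Binary.Permutation.Setoid.Properties (setoid ℤ)
  using (foldr-commMonoid)

open import Defs

private
  variable
    d e j k m n p : ℕ
    s x y z w : ℤ

unique∧set⇒↭ : ∀ {A : Set} {xs ys : List A} → Unique xs → Unique ys →
               (∀ {x} → x ∈ xs ⇔ x ∈ ys) → xs ↭ ys
unique∧set⇒↭ xs! ys! same = ∼bag⇒↭ (unique∧set⇒bag xs! ys! same)

T-does⁻ : ∀ {A : Set} (a? : Dec A) → T (does a?) → A
T-does⁻ (yes a) _ = a

T-does⁺ : ∀ {A : Set} (a? : Dec A) → A → T (does a?)
T-does⁺ (yes _) _ = tt
T-does⁺ (no ¬a) a = ¬a a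

-- Congruence and association modulo n

module _ where
  open import Data.Integer using (_+_; _-_; _*_)

  -- Defs' congruence is stated through ∣ x - y ∣, from which unification cannot recover x
  -- and y; this record is the same relation with x and y as indices.
  record _≡_⟨mod_⟩ (x y : ℤ) (n : ℕ) : Set where
    constructor ⟨_⟩
    field ∣-difference : + n ℤ.∣ x - y

  infix 4 _≡_⟨mod_⟩

  fromDefs : ∀ x y → x ≡ y [mod n ] → x ≡ y ⟨mod n ⟩
  fromDefs _ _ n∣x-y = ⟨ ℤ.∣ᵤ⇒∣ n∣x-y ⟩

  toDefs : x ≡ y ⟨mod n ⟩ → x ≡ y [mod n ]
  toDefs ⟨ n∣x-y ⟩ = ℤ.∣⇒∣ᵤ n∣x-y

  ≡⇒≡⟨mod⟩ : x ≡ y → x ≡ y ⟨mod n ⟩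
  ≡⇒≡⟨mod⟩ {x} refl = ⟨ subst (_ ℤ.∣_) (sym (ℤ.+-inverseʳ x)) (ℤ.divides 0ℤ refl) ⟩

  ≡⟨mod⟩-refl : x ≡ x ⟨mod n ⟩
  ≡⟨mod⟩-refl = ≡⇒≡⟨mod⟩ refl

  ≡⟨mod⟩-sym : x ≡ y ⟨mod n ⟩ → y ≡ x ⟨mod n ⟩
  ≡⟨mod⟩-sym {x} {y} ⟨ n∣x-y ⟩ = ⟨ subst (_ ℤ.∣_) (lemma x y) (ℤ.∣m⇒∣-m n∣x-y) ⟩
    where
    lemma : ∀ x y → - (x - y) ≡ y - x
    lemma = solve-∀

  ≡⟨mod⟩-trans : x ≡ y ⟨mod n ⟩ → y ≡ z ⟨mod n ⟩ → x ≡ z ⟨mod n ⟩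
  ≡⟨mod⟩-trans {x} {y} {z = z} ⟨ n∣x-y ⟩ ⟨ n∣y-z ⟩ =
    ⟨ subst (_ ℤ.∣_) (lemma x y z) (ℤ.∣m∣n⇒∣m+n n∣x-y n∣y-z) ⟩
    where
    lemma : ∀ x y z → (x - y) + (y - z) ≡ x - z
    lemma = solve-∀

  ≡⟨mod⟩-setoid : ℕ → Setoid _ _
  ≡⟨mod⟩-setoid n = record
    { _≈_ = λ x y → x ≡ y ⟨mod n ⟩
    ; isEquivalence = record { refl = ≡⟨mod⟩-refl ; sym = ≡⟨mod⟩-sym ; trans = ≡⟨mod⟩-trans }
    }

  ≡⟨mod⟩-+ : x ≡ y ⟨mod n ⟩ → z ≡ w ⟨mod n ⟩ → x + z ≡ y + w ⟨mod n ⟩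
  ≡⟨mod⟩-+ {x} {y} {z = z} {w} ⟨ n∣x-y ⟩ ⟨ n∣z-w ⟩ =
    ⟨ subst (_ ℤ.∣_) (lemma x y z w) (ℤ.∣m∣n⇒∣m+n n∣x-y n∣z-w) ⟩
    where
    lemma : ∀ x y z w → (x - y) + (z - w) ≡ (x + z) - (y + w)
    lemma = solve-∀

  ≡⟨mod⟩-* : x ≡ y ⟨mod n ⟩ → z ≡ w ⟨mod n ⟩ → x * z ≡ y * w ⟨mod n ⟩
  ≡⟨mod⟩-* {x} {y} {z = z} {w} ⟨ n∣x-y ⟩ ⟨ n∣z-w ⟩ =
    ⟨ subst (_ ℤ.∣_) (lemma x y z w) (ℤ.∣m∣n⇒∣m+n (ℤ.∣n⇒∣m*n x n∣z-w) (ℤ.∣m⇒∣m*n w n∣x-y)) ⟩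
    where
    lemma : ∀ x y z w → x * (z - w) + (x - y) * w ≡ x * z - y * w
    lemma = solve-∀

  ≡⟨mod⟩-*ˡ : ∀ x → y ≡ z ⟨mod n ⟩ → x * y ≡ x * z ⟨mod n ⟩
  ≡⟨mod⟩-*ˡ x = ≡⟨mod⟩-* (≡⟨mod⟩-refl {x = x})

  ≡⟨mod⟩-*ʳ : ∀ z → x ≡ y ⟨mod n ⟩ → x * z ≡ y * z ⟨mod n ⟩
  ≡⟨mod⟩-*ʳ z x≡y = ≡⟨mod⟩-* x≡y (≡⟨mod⟩-refl {x = z})

  ≡⟨mod⟩-∣ : m ∣ n → x ≡ y ⟨mod n ⟩ → x ≡ y ⟨mod m ⟩
  ≡⟨mod⟩-∣ m∣n ⟨ n∣x-y ⟩ = ⟨ ℤ.∣-trans (ℤ.∣ᵤ⇒∣ m∣n) n∣x-y ⟩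

  ≡⟨mod1⟩ : x ≡ y ⟨mod 1 ⟩
  ≡⟨mod1⟩ {x} {y} = ⟨ ℤ.divides (x - y) (sym (ℤ.*-identityʳ (x - y))) ⟩

  ≡⟨mod⟩-sum : ∀ {A : Set} (f g : A → ℤ) {xs} → All (λ e → f e ≡ g e ⟨mod n ⟩) xs →
               sumℤ (map f xs) ≡ sumℤ (map g xs) ⟨mod n ⟩
  ≡⟨mod⟩-sum f g []          = ≡⟨mod⟩-refl
  ≡⟨mod⟩-sum f g (fe≡ge ∷ r) = ≡⟨mod⟩-+ fe≡ge (≡⟨mod⟩-sum f g r)

  record InvertibleMod (u : ℤ) (n : ℕ) : Set where
    constructor _,_
    field
      inverse         : ℤ
      inverse-correct : u * inverse ≡ 1ℤ ⟨mod n ⟩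

  invertible-1 : InvertibleMod 1ℤ n
  invertible-1 = 1ℤ , ≡⟨mod⟩-refl

  invertible-* : ∀ {u v} → InvertibleMod u n → InvertibleMod v n → InvertibleMod (u * v) n
  invertible-* {n} {u} {v} (u⁻¹ , uu⁻¹≡1) (v⁻¹ , vv⁻¹≡1) = u⁻¹ * v⁻¹ , (begin
    (u * v) * (u⁻¹ * v⁻¹)   ≡⟨ lemma u v u⁻¹ v⁻¹ ⟩
    (u * u⁻¹) * (v * v⁻¹)   ≈⟨ ≡⟨mod⟩-* uu⁻¹≡1 vv⁻¹≡1 ⟩
    1ℤ                      ∎)
    where
    open SetoidReasoning (≡⟨mod⟩-setoid n)
    lemma : ∀ u v u⁻¹ v⁻¹ → (u * v) * (u⁻¹ * v⁻¹) ≡ (u * u⁻¹) * (v * v⁻¹)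
    lemma = solve-∀

  invertible-∣ : ∀ {u} → m ∣ n → InvertibleMod u n → InvertibleMod u m
  invertible-∣ m∣n (u⁻¹ , uu⁻¹≡1) = u⁻¹ , ≡⟨mod⟩-∣ m∣n uu⁻¹≡1

  invertible⇒≢0 : ∀ {u} → 2 ≤ n → InvertibleMod u n → u ≢ 0ℤ
  invertible⇒≢0 2≤n (_ , ⟨ n∣-1 ⟩) refl with ∣1⇒≡1 (ℤ.∣⇒∣ᵤ n∣-1)
  invertible⇒≢0 (ℕ.s≤s ()) _ refl | refl

  inverse-injective : ∀ {u v u⁻¹ v⁻¹} → u * u⁻¹ ≡ 1ℤ ⟨mod n ⟩ → v * v⁻¹ ≡ 1ℤ ⟨mod n ⟩ →
                      u⁻¹ ≡ v⁻¹ ⟨mod n ⟩ → u ≡ v ⟨mod n ⟩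
  inverse-injective {n} {u} {v} {u⁻¹} {v⁻¹} uu⁻¹≡1 vv⁻¹≡1 u⁻¹≡v⁻¹ = begin
    u               ≡⟨ ℤ.*-identityʳ u ⟨
    u * 1ℤ          ≈⟨ ≡⟨mod⟩-*ˡ u (≡⟨mod⟩-sym vv⁻¹≡1) ⟩
    u * (v * v⁻¹)   ≡⟨ lemma u v v⁻¹ ⟩
    v * (u * v⁻¹)   ≈⟨ ≡⟨mod⟩-*ˡ v (≡⟨mod⟩-*ˡ u (≡⟨mod⟩-sym u⁻¹≡v⁻¹)) ⟩
    v * (u * u⁻¹)   ≈⟨ ≡⟨mod⟩-*ˡ v uu⁻¹≡1 ⟩
    v * 1ℤ          ≡⟨ ℤ.*-identityʳ v ⟩
    v               ∎
    where
    open SetoidReasoning (≡⟨mod⟩-setoid n)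
    lemma : ∀ u v w → u * (v * w) ≡ v * (u * w)
    lemma = solve-∀

  record _≃_⟨mod_⟩ (x y : ℤ) (n : ℕ) : Set where
    field
      u v          : ℤ
      u-invertible : InvertibleMod u n
      v-invertible : InvertibleMod v n
      u≡v          : u ≡ v ⟨mod n ⟩
      ux≡vy        : u * x ≡ v * y

  infix 4 _≃_⟨mod_⟩

  open _≃_⟨mod_⟩

  ≃-refl : x ≃ x ⟨mod n ⟩
  ≃-refl = record
    { u = 1ℤ ; v = 1ℤ ; u-invertible = invertible-1 ; v-invertible = invertible-1
    ; u≡v = ≡⟨mod⟩-refl ; ux≡vy = refl }

  ≃-sym : x ≃ y ⟨mod n ⟩ → y ≃ x ⟨mod n ⟩
  ≃-sym x≃y = record
    { u = v x≃y ; v = u x≃y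
    ; u-invertible = v-invertible x≃y ; v-invertible = u-invertible x≃y
    ; u≡v = ≡⟨mod⟩-sym (u≡v x≃y) ; ux≡vy = sym (ux≡vy x≃y) }

  ≃-* : x ≃ y ⟨mod n ⟩ → z ≃ w ⟨mod n ⟩ → x * z ≃ y * w ⟨mod n ⟩
  ≃-* {x} {y} {z = z} {w} x≃y z≃w = record
    { u = u x≃y * u z≃w
    ; v = v x≃y * v z≃w
    ; u-invertible = invertible-* (u-invertible x≃y) (u-invertible z≃w)
    ; v-invertible = invertible-* (v-invertible x≃y) (v-invertible z≃w)
    ; u≡v = ≡⟨mod⟩-* (u≡v x≃y) (u≡v z≃w)
    ; ux≡vy = begin
        (u x≃y * u z≃w) * (x * z)   ≡⟨ lemma (u x≃y) (u z≃w) x z ⟩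
        (u x≃y * x) * (u z≃w * z)   ≡⟨ cong₂ _*_ (ux≡vy x≃y) (ux≡vy z≃w) ⟩
        (v x≃y * y) * (v z≃w * w)   ≡⟨ lemma (v x≃y) (v z≃w) y w ⟨
        (v x≃y * v z≃w) * (y * w)   ∎
    }
    where
    open ≡-Reasoning
    lemma : ∀ a b c d → (a * b) * (c * d) ≡ (a * c) * (b * d)
    lemma = solve-∀

  ≃-product : ∀ {A : Set} (f g : A → ℤ) {xs} → All (λ e → f e ≃ g e ⟨mod n ⟩) xs →
              prodℤ (map f xs) ≃ prodℤ (map g xs) ⟨mod n ⟩
  ≃-product f g []          = ≃-refl
  ≃-product f g (fe≃ge ∷ r) = ≃-* fe≃ge (≃-product f g r)

  ≃-cancelʳ : x * z ≃ y * w ⟨mod n ⟩ → z ≃ w ⟨mod n ⟩ → z ≢ 0ℤ → x ≃ y ⟨mod n ⟩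
  ≃-cancelʳ {x} {z} {y} {w} xz≃yw z≃w z≢0 = record
    { u = u xz≃yw * v z≃w
    ; v = v xz≃yw * u z≃w
    ; u-invertible = invertible-* (u-invertible xz≃yw) (v-invertible z≃w)
    ; v-invertible = invertible-* (v-invertible xz≃yw) (u-invertible z≃w)
    ; u≡v = ≡⟨mod⟩-* (u≡v xz≃yw) (≡⟨mod⟩-sym (u≡v z≃w))
    ; ux≡vy = ℤ.*-cancelʳ-≡ _ _ z {{ℤ.≢-nonZero z≢0}} (begin
        ((u xz≃yw * v z≃w) * x) * z   ≡⟨ lemma₁ (u xz≃yw) (v z≃w) x z ⟩
        v z≃w * (u xz≃yw * (x * z))   ≡⟨ cong (v z≃w *_) (ux≡vy xz≃yw) ⟩
        v z≃w * (v xz≃yw * (y * w))   ≡⟨ lemma₂ (v z≃w) (v xz≃yw) y w ⟩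
        (v xz≃yw * y) * (v z≃w * w)   ≡⟨ cong (v xz≃yw * y *_) (ux≡vy z≃w) ⟨
        (v xz≃yw * y) * (u z≃w * z)   ≡⟨ lemma₃ (v xz≃yw) y (u z≃w) z ⟩
        ((v xz≃yw * u z≃w) * y) * z   ∎)
    }
    where
    open ≡-Reasoning
    lemma₁ : ∀ a b x z → ((a * b) * x) * z ≡ b * (a * (x * z))
    lemma₁ = solve-∀
    lemma₂ : ∀ b a y w → b * (a * (y * w)) ≡ (a * y) * (b * w)
    lemma₂ = solve-∀
    lemma₃ : ∀ a y b z → (a * y) * (b * z) ≡ ((a * b) * y) * z
    lemma₃ = solve-∀

  ≃-∣ : m ∣ n → x ≃ y ⟨mod n ⟩ → x ≃ y ⟨mod m ⟩
  ≃-∣ m∣n x≃y = record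
    { u = u x≃y ; v = v x≃y
    ; u-invertible = invertible-∣ m∣n (u-invertible x≃y)
    ; v-invertible = invertible-∣ m∣n (v-invertible x≃y)
    ; u≡v = ≡⟨mod⟩-∣ m∣n (u≡v x≃y) ; ux≡vy = ux≡vy x≃y }

  ≃⇒≡⟨mod⟩ : x ≃ y ⟨mod n ⟩ → x ≡ y ⟨mod n ⟩
  ≃⇒≡⟨mod⟩ {x} {y} {n} record
    { u = u ; v = v ; u-invertible = u⁻¹ , uu⁻¹≡1 ; u≡v = u≡v ; ux≡vy = ux≡vy } = begin
      x                 ≡⟨ ℤ.*-identityˡ x ⟨
      1ℤ * x            ≈⟨ ≡⟨mod⟩-*ʳ x (≡⟨mod⟩-sym uu⁻¹≡1) ⟩
      (u * u⁻¹) * x     ≡⟨ lemma u u⁻¹ x ⟩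
      u⁻¹ * (u * x)     ≡⟨ cong (u⁻¹ *_) ux≡vy ⟩
      u⁻¹ * (v * y)     ≈⟨ ≡⟨mod⟩-*ˡ u⁻¹ (≡⟨mod⟩-*ʳ y (≡⟨mod⟩-sym u≡v)) ⟩
      u⁻¹ * (u * y)     ≡⟨ lemma u u⁻¹ y ⟨
      (u * u⁻¹) * y     ≈⟨ ≡⟨mod⟩-*ʳ y uu⁻¹≡1 ⟩
      1ℤ * y            ≡⟨ ℤ.*-identityˡ y ⟩
      y                 ∎
    where
    open SetoidReasoning (≡⟨mod⟩-setoid n)
    lemma : ∀ u u⁻¹ x → (u * u⁻¹) * x ≡ u⁻¹ * (u * x)
    lemma = solve-∀

  ≃-from-congruent-inverses : ∀ {A B g} P M {P⁻¹ M⁻¹} → P * g ≡ A → M * g ≡ B →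
    P * P⁻¹ ≡ 1ℤ ⟨mod n ⟩ → M * M⁻¹ ≡ 1ℤ ⟨mod n ⟩ → M⁻¹ ≡ P⁻¹ ⟨mod n ⟩ → A ≃ B ⟨mod n ⟩
  ≃-from-congruent-inverses {g = g} P M {P⁻¹} {M⁻¹} refl refl PP⁻¹≡1 MM⁻¹≡1 M⁻¹≡P⁻¹ = record
    { u = M ; v = P
    ; u-invertible = M⁻¹ , MM⁻¹≡1
    ; v-invertible = P⁻¹ , PP⁻¹≡1
    ; u≡v = inverse-injective MM⁻¹≡1 PP⁻¹≡1 M⁻¹≡P⁻¹
    ; ux≡vy = lemma M P g }
    where
    lemma : ∀ M P g → M * (P * g) ≡ P * (M * g)
    lemma = solve-∀

module _ (a : Seq) (seg : StrongEulerGauss a) {n : ℕ} (1≤n : 1 ≤ n) where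

  A⁺≃A⁻ : A⁺ a n ≃ A⁻ a n ⟨mod n ⟩
  A⁺≃A⁻ with seg n 1≤n
  ... | _ , P , M , Pg≡A⁺ , Mg≡A⁻ , P⁻¹ , M⁻¹ , PP⁻¹≡1 , MM⁻¹≡1 , M⁻¹≡P⁻¹ =
    ≃-from-congruent-inverses P M Pg≡A⁺ Mg≡A⁻
      (fromDefs (P ℤ.* P⁻¹) 1ℤ PP⁻¹≡1) (fromDefs (M ℤ.* M⁻¹) 1ℤ MM⁻¹≡1) (fromDefs M⁻¹ P⁻¹ M⁻¹≡P⁻¹)

  A⁺≢0 : 2 ≤ n → A⁺ a n ≢ 0ℤ
  A⁺≢0 2≤n A⁺≡0 with seg n 1≤n
  ... | g≢0 , P , _ , Pg≡A⁺ , _ , P⁻¹ , _ , PP⁻¹≡1 , _ with ℤ.i*j≡0⇒i≡0∨j≡0 P (trans Pg≡A⁺ A⁺≡0)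
  ...   | inj₁ P≡0 = invertible⇒≢0 2≤n (P⁻¹ , fromDefs (P ℤ.* P⁻¹) 1ℤ PP⁻¹≡1) P≡0
  ...   | inj₂ g≡0 = g≢0 g≡0

-- Prime powers and coprimality

open import Data.Nat using (_*_; _^_)

prime⇒1< : Prime p → 1 < p
prime⇒1< {p} prime-p = ℕ.nonTrivial⇒n>1 p {{prime⇒nonTrivial prime-p}}

∤⇒nonZero : ¬ p ∣ m → NonZero m
∤⇒nonZero {p} {zero}  p∤0 = contradiction (p ∣0) p∤0
∤⇒nonZero {m = suc _} _   = _

prime∤⇒coprime : Prime p → ¬ p ∣ n → Coprime n p
prime∤⇒coprime prime-p p∤n (i∣n , i∣p) with prime⇒irreducible prime-p i∣p
... | inj₁ i≡1 = i≡1
... | inj₂ refl = contradiction i∣n p∤n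

coprime-^ : Prime p → ¬ p ∣ m → Coprime (p ^ k) m
coprime-^ {k = zero} _ _ (i∣1 , _) = ∣1⇒≡1 i∣1
coprime-^ {p} {m} {suc k} prime-p p∤m {i} (i∣p*p^k , i∣m) =
  coprime-^ {k = k} prime-p p∤m (coprime-divisor (prime∤⇒coprime prime-p p∤i) i∣p*p^k , i∣m)
  where
  p∤i : ¬ p ∣ i
  p∤i p∣i = p∤m (∣-trans p∣i i∣m)

∣p^k*m⇒∣m : Prime p → ¬ p ∣ d → d ∣ p ^ k * m → d ∣ m
∣p^k*m⇒∣m {k = k} prime-p p∤d = coprime-divisor (Coprime.sym (coprime-^ {k = k} prime-p p∤d))

coprime⇒*∣ : Coprime m n → m ∣ k → n ∣ k → m * n ∣ k
coprime⇒*∣ {m} {n} coprime m∣k n∣k = subst (_∣ _) lcm≡m*n (lcm-least m∣k n∣k)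
  where
  lcm≡m*n : lcm m n ≡ m * n
  lcm≡m*n = trans (sym (ℕ.*-identityˡ (lcm m n)))
              (trans (cong (_* lcm m n) (sym (coprime⇒gcd≡1 coprime))) (gcd*lcm m n))

p-free-factorisation : 1 < p → ∀ n → .{{_ : NonZero n}} → ∃₂ λ k m → n ≡ p ^ k * m × ¬ p ∣ m
p-free-factorisation {p} 1<p = <-rec _ step
  where
  step : ∀ n → (∀ {n′} → n′ < n → .{{_ : NonZero n′}} → ∃₂ λ k m → n′ ≡ p ^ k * m × ¬ p ∣ m) →
         .{{_ : NonZero n}} → ∃₂ λ k m → n ≡ p ^ k * m × ¬ p ∣ m
  step n rec with p ∣? n
  ... | no p∤n = 0 , n , sym (ℕ.*-identityˡ n) , p∤n
  ... | yes (divides n′ refl)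
    with k , m , refl , p∤m ← rec (ℕ.m<m*n n′ p {{ℕ.m*n≢0⇒m≢0 n′}} 1<p) {{ℕ.m*n≢0⇒m≢0 n′}} =
    suc k , m , trans (ℕ.*-comm _ p) (sym (ℕ.*-assoc p (p ^ k) m)) , p∤m

∃-prime-divisor : 2 ≤ n → ∃[ p ] Prime p × p ∣ n
∃-prime-divisor {suc zero} (ℕ.s≤s ())
∃-prime-divisor {n@(suc (suc _))} _ with factorise n
... | record { factors = [] ; isFactorisation = () }
... | record { factors = p ∷ _ ; isFactorisation = n≡∏ ; factorsPrime = prime-p ∷ _ } =
  p , prime-p , subst (p ∣_) (sym n≡∏) (m∣m*n _)

∣-from-prime-powers : ∀ n → .{{_ : NonZero n}} → (∀ p k → Prime p → p ^ k ∣ n → p ^ k ∣ m) → n ∣ m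
∣-from-prime-powers {m} = <-rec _ step
  where
  PrimePowersDivide : ℕ → Set
  PrimePowersDivide n = ∀ p k → Prime p → p ^ k ∣ n → p ^ k ∣ m

  step : ∀ n → (∀ {n′} → n′ < n → .{{_ : NonZero n′}} → PrimePowersDivide n′ → n′ ∣ m) →
         .{{_ : NonZero n}} → PrimePowersDivide n → n ∣ m
  step 1 _ _ = 1∣ m
  step n@(suc (suc _)) rec p^k∣m with ∃-prime-divisor {n} (ℕ.s≤s (ℕ.s≤s ℕ.z≤n))
  ... | p , prime-p , p∣n with p-free-factorisation (prime⇒1< prime-p) n
  ...   | zero , n′ , n≡n′ , p∤n′ =
    contradiction (subst (p ∣_) (trans n≡n′ (ℕ.*-identityˡ n′)) p∣n) p∤n′
  ...   | suc k , n′ , n≡p^k*n′ , p∤n′ = subst (_∣ m) (sym n≡p^k*n′)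
    (coprime⇒*∣ (coprime-^ {k = suc k} prime-p p∤n′)
       (p^k∣m p (suc k) prime-p (subst (p ^ suc k ∣_) (sym n≡p^k*n′) (m∣m*n n′)))
       (rec n′<n {{∤⇒nonZero p∤n′}} λ q j prime-q q^j∣n′ → p^k∣m q j prime-q (∣-trans q^j∣n′ n′∣n)))
    where
    n′∣n : n′ ∣ n
    n′∣n = subst (n′ ∣_) (sym n≡p^k*n′) (n∣m*n (p ^ suc k))
    n′<n : n′ < n
    n′<n = subst (n′ <_) (trans (ℕ.*-comm n′ _) (sym n≡p^k*n′))
             (ℕ.m<m*n n′ (p ^ suc k) {{∤⇒nonZero p∤n′}}
                (ℕ.^-monoʳ-< p (prime⇒1< prime-p) {0} {suc k} ℕ.z<s))

-- The Möbius function

-1^k≡1⊎-1 : ∀ k → -1ℤ ℤ.^ k ≡ 1ℤ ⊎ -1ℤ ℤ.^ k ≡ -1ℤ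
-1^k≡1⊎-1 zero = inj₁ refl
-1^k≡1⊎-1 (suc k) with -1^k≡1⊎-1 k
... | inj₁ eq = inj₂ (cong (-1ℤ ℤ.*_) eq)
... | inj₂ eq = inj₁ (cong (-1ℤ ℤ.*_) eq)

μ-trichotomy : ∀ d → μ d ≡ 0ℤ ⊎ μ d ≡ 1ℤ ⊎ μ d ≡ -1ℤ
μ-trichotomy d with hasSquareFactor d
... | true  = inj₁ refl
... | false = inj₂ (-1^k≡1⊎-1 (ω d))

hasSquareFactor⁻ : T (hasSquareFactor n) → ∃[ k ] 2 ≤ k × k * k ∣ n
hasSquareFactor⁻ {n} sf with satisfied (any⁻ _ (upTo n) sf)
... | i , [2+i]²∣n = suc (suc i) , ℕ.s≤s (ℕ.s≤s ℕ.z≤n) , T-does⁻ (_ ∣? n) [2+i]²∣n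

hasSquareFactor⁺ : .{{_ : NonZero n}} → 2 ≤ k → k * k ∣ n → T (hasSquareFactor n)
hasSquareFactor⁺ {k = 1} (ℕ.s≤s ())
hasSquareFactor⁺ {n} {k = suc (suc i)} _ k²∣n = any⁺ _ (lose (∈-upTo⁺ i<n) (T-does⁺ (_ ∣? n) k²∣n))
  where
  i<n : i < n
  i<n = ℕ.<-≤-trans (ℕ.≤-trans (ℕ.n≤1+n (suc i)) (ℕ.m≤m*n (suc (suc i)) (suc (suc i)))) (∣⇒≤ k²∣n)

square∣p*e⇒square∣e : Prime p → ¬ p ∣ e → k * k ∣ p * e → k * k ∣ e
square∣p*e⇒square∣e {p} {e} {k} prime-p p∤e k²∣pe with p ∣? k * k
... | no p∤k² = coprime-divisor (prime∤⇒coprime prime-p p∤k²) k²∣pe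
... | yes p∣k² = contradiction p∣e p∤e
  where
  p∣k : p ∣ k
  p∣k = [ id , id ] (euclidsLemma k k prime-p p∣k²)
  p∣e : p ∣ e
  p∣e = *-cancelˡ-∣ p {{prime⇒nonZero prime-p}} (∣-trans (*-pres-∣ p∣k p∣k) k²∣pe)

hasSquareFactor-*-prime : Prime p → ¬ p ∣ e → T (hasSquareFactor (p * e)) ⇔ T (hasSquareFactor e)
hasSquareFactor-*-prime {p} {e} prime-p p∤e = mk⇔ to from
  where
  instance
    _ = ∤⇒nonZero p∤e
    _ = ℕ.m*n≢0 p e {{prime⇒nonZero prime-p}}
  to : T (hasSquareFactor (p * e)) → T (hasSquareFactor e)
  to sf with hasSquareFactor⁻ sf
  ... | k , 2≤k , k²∣pe = hasSquareFactor⁺ 2≤k (square∣p*e⇒square∣e {k = k} prime-p p∤e k²∣pe)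
  from : T (hasSquareFactor e) → T (hasSquareFactor (p * e))
  from sf with hasSquareFactor⁻ sf
  ... | k , 2≤k , k²∣e = hasSquareFactor⁺ 2≤k (∣n⇒∣m*n p k²∣e)

-- ω n unfolds to length (primeDivisors n)
primeDivisors : ℕ → List ℕ
primeDivisors n = filter (λ q → prime? q ×-dec q ∣? n) (upTo (suc n))

∈-primeDivisors⁻ : ∀ {q} → q ∈ primeDivisors n → Prime q × q ∣ n
∈-primeDivisors⁻ {n} q∈ = proj₂ (∈-filter⁻ (λ q → prime? q ×-dec q ∣? n) {xs = upTo (suc n)} q∈)

∈-primeDivisors⁺ : ∀ {q} → .{{_ : NonZero n}} → Prime q → q ∣ n → q ∈ primeDivisors n
∈-primeDivisors⁺ {n} prime-q q∣n =
  ∈-filter⁺ (λ q → prime? q ×-dec q ∣? n) (∈-upTo⁺ (ℕ.s≤s (∣⇒≤ q∣n))) (prime-q , q∣n)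

primeDivisors-unique : ∀ n → Unique (primeDivisors n)
primeDivisors-unique n = Unique.filter⁺ (λ q → prime? q ×-dec q ∣? n) (Unique.upTo⁺ (suc n))

primeDivisors-*-prime : Prime p → ¬ p ∣ e → primeDivisors (p * e) ↭ p ∷ primeDivisors e
primeDivisors-*-prime {p} {e} prime-p p∤e =
  unique∧set⇒↭ (primeDivisors-unique (p * e)) (p∉ ∷ primeDivisors-unique e) (mk⇔ to from)
  where
  instance
    _ = ∤⇒nonZero p∤e
    _ = ℕ.m*n≢0 p e {{prime⇒nonZero prime-p}}
  p∉ : All (p ≢_) (primeDivisors e)
  p∉ = All.tabulate λ q∈ p≡q → p∤e (subst (_∣ e) (sym p≡q) (proj₂ (∈-primeDivisors⁻ q∈)))
  to : ∀ {q} → q ∈ primeDivisors (p * e) → q ∈ p ∷ primeDivisors e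
  to q∈ with ∈-primeDivisors⁻ q∈
  ... | prime-q , q∣pe with euclidsLemma p e prime-q q∣pe
  ...   | inj₂ q∣e = there (∈-primeDivisors⁺ prime-q q∣e)
  ...   | inj₁ q∣p with prime⇒irreducible prime-p q∣p
  ...     | inj₁ refl = contradiction prime-q ¬prime[1]
  ...     | inj₂ refl = here refl
  from : ∀ {q} → q ∈ p ∷ primeDivisors e → q ∈ primeDivisors (p * e)
  from (here refl) = ∈-primeDivisors⁺ prime-p (m∣m*n e)
  from (there q∈) with ∈-primeDivisors⁻ q∈
  ... | prime-q , q∣e = ∈-primeDivisors⁺ prime-q (∣n⇒∣m*n p q∣e)

ω-*-prime : Prime p → ¬ p ∣ e → ω (p * e) ≡ suc (ω e)
ω-*-prime prime-p p∤e = ↭.↭-length (primeDivisors-*-prime prime-p p∤e)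

μ-*-prime : Prime p → ¬ p ∣ e → μ (p * e) ≡ - μ e
μ-*-prime {p} {e} prime-p p∤e with hasSquareFactor (p * e) in sf[pe] | hasSquareFactor e in sf[e]
... | true  | true  = refl
... | false | false = trans (cong (-1ℤ ℤ.^_) (ω-*-prime prime-p p∤e)) (ℤ.-1*i≡-i _)
... | true  | false = ⊥-elim (subst T sf[e]
  (Equivalence.to (hasSquareFactor-*-prime prime-p p∤e) (subst T (sym sf[pe]) tt)))
... | false | true  = ⊥-elim (subst T sf[pe]
  (Equivalence.from (hasSquareFactor-*-prime prime-p p∤e) (subst T (sym sf[e]) tt)))

μ-square : Prime p → .{{_ : NonZero d}} → p * p ∣ d → μ d ≡ 0ℤ
μ-square {p} {d} prime-p p²∣d with hasSquareFactor d in sf[d]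
... | true  = refl
... | false = ⊥-elim (subst T sf[d] (hasSquareFactor⁺ (prime⇒1< prime-p) p²∣d))

-- Divisors of p^(j+1) m

μ-divisors : ℕ → ℤ → List ℕ
μ-divisors n s = map suc (filter (λ k → μ (suc k) ℤ.≟ s) (divisorsPred n))

∈-μ-divisors⁻ : ∀ n s → d ∈ μ-divisors n s → NonZero d × d ∣ n × μ d ≡ s
∈-μ-divisors⁻ n s d∈ with ∈-map⁻ suc d∈
... | k , k∈ , refl with ∈-filter⁻ (λ k → μ (suc k) ℤ.≟ s) {xs = divisorsPred n} k∈
... | k∈divisorsPred , μd≡s =
  _ , proj₂ (∈-filter⁻ (λ k → suc k ∣? n) {xs = upTo n} k∈divisorsPred) , μd≡s

∈-μ-divisors⁺ : .{{_ : NonZero n}} → d ∣ n → μ d ≡ s → d ∈ μ-divisors n s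
∈-μ-divisors⁺ {n} {zero} 0∣n _ = contradiction (0∣⇒≡0 0∣n) (ℕ.≢-nonZero⁻¹ n)
∈-μ-divisors⁺ {n} {suc k} {s} d∣n μd≡s =
  ∈-map⁺ suc (∈-filter⁺ (λ k → μ (suc k) ℤ.≟ s)
    (∈-filter⁺ (λ k → suc k ∣? n) (∈-upTo⁺ (∣⇒≤ d∣n)) d∣n) μd≡s)

μ-divisors-unique : ∀ n s → Unique (μ-divisors n s)
μ-divisors-unique n s = Unique.map⁺ ℕ.suc-injective
  (Unique.filter⁺ (λ k → μ (suc k) ℤ.≟ s) (Unique.filter⁺ (λ k → suc k ∣? n) (Unique.upTo⁺ n)))

μ-divisors-head : ∀ m → ∃[ ds ] μ-divisors (suc m) 1ℤ ≡ 1 ∷ ds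
μ-divisors-head m = _ , cong (map suc ∘ filter (λ k → μ (suc k) ℤ.≟ 1ℤ))
                             (List.filter-accept (λ k → suc k ∣? suc m) (1∣ suc m))

divisor-of-p^[1+j]*m : Prime p → ¬ p ∣ m → .{{_ : NonZero d}} → d ∣ p ^ suc j * m → μ d ≢ 0ℤ →
  d ∣ m ⊎ ∃[ e ] d ≡ p * e × e ∣ m × μ e ≡ - μ d
divisor-of-p^[1+j]*m {p} {m} {d} {j} prime-p p∤m d∣p^[1+j]*m μd≢0 with p ∣? d
... | no p∤d = inj₁ (∣p^k*m⇒∣m {k = suc j} prime-p p∤d d∣p^[1+j]*m)
... | yes (divides e refl) = inj₂ (e , ℕ.*-comm e p , e∣m , μe≡-μd)
  where
  instance
    _ = prime⇒nonZero prime-p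
    _ = ℕ.m*n≢0⇒m≢0 e
  p∤e : ¬ p ∣ e
  p∤e p∣e = μd≢0 (μ-square prime-p (*-monoˡ-∣ p p∣e))
  e∣m : e ∣ m
  e∣m = ∣p^k*m⇒∣m {k = j} prime-p p∤e
          (*-cancelˡ-∣ p (subst₂ _∣_ (ℕ.*-comm e p) (ℕ.*-assoc p (p ^ j) m) d∣p^[1+j]*m))
  μe≡-μd : μ e ≡ - μ (e * p)
  μe≡-μd = trans (sym (ℤ.neg-involutive (μ e)))
             (cong -_ (trans (sym (μ-*-prime prime-p p∤e)) (cong μ (ℕ.*-comm p e))))

μ-divisors-split : Prime p → ¬ p ∣ m → s ≢ 0ℤ →
  μ-divisors (p ^ suc j * m) s ↭ μ-divisors m s ++ map (p *_) (μ-divisors m (- s))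
μ-divisors-split {p} {m} {s} {j} prime-p p∤m s≢0 =
  unique∧set⇒↭ (μ-divisors-unique (p ^ suc j * m) s) rhs-unique (mk⇔ to from)
  where
  instance
    _ = prime⇒nonZero prime-p
    _ = ∤⇒nonZero p∤m
    _ = ℕ.m*n≢0 (p ^ suc j) m {{ℕ.m^n≢0 p (suc j)}}
  rhs-unique : Unique (μ-divisors m s ++ map (p *_) (μ-divisors m (- s)))
  rhs-unique = Unique.++⁺ (μ-divisors-unique m s)
    (Unique.map⁺ (ℕ.*-cancelˡ-≡ _ _ p) (μ-divisors-unique m (- s))) disjoint
    where
    disjoint : ∀ {d} → ¬ (d ∈ μ-divisors m s × d ∈ map (p *_) (μ-divisors m (- s)))
    disjoint (d∈ , pe∈) with ∈-map⁻ (p *_) pe∈ | ∈-μ-divisors⁻ m s d∈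
    ... | e , _ , refl | _ , pe∣m , _ = p∤m (∣-trans (m∣m*n e) pe∣m)
  to : d ∈ μ-divisors (p ^ suc j * m) s → d ∈ μ-divisors m s ++ map (p *_) (μ-divisors m (- s))
  to d∈ with ∈-μ-divisors⁻ (p ^ suc j * m) s d∈
  ... | d≢0 , d∣N , refl with divisor-of-p^[1+j]*m {j = j} prime-p p∤m {{d≢0}} d∣N s≢0
  ...   | inj₁ d∣m = ∈-++⁺ˡ (∈-μ-divisors⁺ d∣m refl)
  ...   | inj₂ (e , refl , e∣m , μe≡-s) =
    ∈-++⁺ʳ (μ-divisors m s) (∈-map⁺ (p *_) (∈-μ-divisors⁺ e∣m μe≡-s))
  from : d ∈ μ-divisors m s ++ map (p *_) (μ-divisors m (- s)) → d ∈ μ-divisors (p ^ suc j * m) s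
  from d∈ with ∈-++⁻ (μ-divisors m s) d∈
  ... | inj₁ d∈ₘ with ∈-μ-divisors⁻ m s d∈ₘ
  ...   | _ , d∣m , μd≡s = ∈-μ-divisors⁺ (∣-trans d∣m (n∣m*n (p ^ suc j))) μd≡s
  from d∈ | inj₂ pe∈ with ∈-map⁻ (p *_) pe∈
  ... | e , e∈ , refl with ∈-μ-divisors⁻ m (- s) e∈
  ...   | _ , e∣m , μe≡-s = ∈-μ-divisors⁺
          (subst (p * e ∣_) (sym (ℕ.*-assoc p (p ^ j) m)) (*-monoʳ-∣ p (∣n⇒∣m*n (p ^ j) e∣m)))
          (trans (μ-*-prime prime-p (λ p∣e → p∤m (∣-trans p∣e e∣m)))
                 (trans (cong -_ μe≡-s) (ℤ.neg-involutive s)))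

module _ {_∙_ : Op₂ ℤ} {ε : ℤ} (isCommutativeMonoid : IsCommutativeMonoid _≡_ _∙_ ε) where
  open IsCommutativeMonoid isCommutativeMonoid using (identityˡ; assoc)

  foldr-++ : ∀ xs ys → foldr _∙_ ε (xs ++ ys) ≡ foldr _∙_ ε xs ∙ foldr _∙_ ε ys
  foldr-++ []       ys = sym (identityˡ _)
  foldr-++ (x ∷ xs) ys = trans (cong (x ∙_) (foldr-++ xs ys)) (sym (assoc x _ _))

  foldr-μ-divisors-split : Prime p → ¬ p ∣ m → s ≢ 0ℤ → (f : ℕ → ℤ) →
    foldr _∙_ ε (map f (μ-divisors (p ^ suc j * m) s)) ≡
      foldr _∙_ ε (map f (μ-divisors m s)) ∙ foldr _∙_ ε (map (f ∘ (p *_)) (μ-divisors m (- s)))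
  foldr-μ-divisors-split {p} {m} {s} {j} prime-p p∤m s≢0 f = begin
    foldr _∙_ ε (map f (μ-divisors (p ^ suc j * m) s))
      ≡⟨ foldr-commMonoid isCommutativeMonoid
           (↭⇒↭ₛ (↭.map⁺ f (μ-divisors-split {j = j} prime-p p∤m s≢0))) ⟩
    foldr _∙_ ε (map f (D₊ ++ map (p *_) D₋))
      ≡⟨ cong (foldr _∙_ ε) (List.map-++ f D₊ (map (p *_) D₋)) ⟩
    foldr _∙_ ε (map f D₊ ++ map f (map (p *_) D₋))
      ≡⟨ foldr-++ (map f D₊) (map f (map (p *_) D₋)) ⟩
    foldr _∙_ ε (map f D₊) ∙ foldr _∙_ ε (map f (map (p *_) D₋))
      ≡⟨ cong (λ ds → foldr _∙_ ε (map f D₊) ∙ foldr _∙_ ε ds) (List.map-∘ D₋) ⟨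
    foldr _∙_ ε (map f D₊) ∙ foldr _∙_ ε (map (f ∘ (p *_)) D₋)
      ∎
    where
    open ≡-Reasoning
    D₊ = μ-divisors m s
    D₋ = μ-divisors m (- s)

sumℤ-signed : ∀ {A : Set} (w h : A → ℤ) → (∀ x → w x ≡ 0ℤ ⊎ w x ≡ 1ℤ ⊎ w x ≡ -1ℤ) → ∀ xs →
  sumℤ (map (λ x → w x ℤ.* h x) xs) ≡
    sumℤ (map h (filter (λ x → w x ℤ.≟ 1ℤ) xs)) ℤ.- sumℤ (map h (filter (λ x → w x ℤ.≟ -1ℤ) xs))
sumℤ-signed w h w∈ [] = refl
sumℤ-signed w h w∈ (x ∷ xs) with w∈ x
... | inj₁ w≡0 rewrite w≡0 | sumℤ-signed w h w∈ xs = ℤ.+-identityˡ _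
... | inj₂ (inj₁ w≡1) rewrite w≡1 | sumℤ-signed w h w∈ xs = lemma (h x) _ _
  where
  lemma : ∀ a A B → 1ℤ ℤ.* a ℤ.+ (A ℤ.- B) ≡ (a ℤ.+ A) ℤ.- B
  lemma = solve-∀
... | inj₂ (inj₂ w≡-1) rewrite w≡-1 | sumℤ-signed w h w∈ xs =
  lemma (h x) (sumℤ (map h (filter (λ x → w x ℤ.≟ 1ℤ) xs)))
              (sumℤ (map h (filter (λ x → w x ℤ.≟ -1ℤ) xs)))
  where
  lemma : ∀ a A B → -1ℤ ℤ.* a ℤ.+ (A ℤ.- B) ≡ A ℤ.- (a ℤ.+ B)
  lemma = solve-∀

-- n / d, with the junk value 0 at d = 0 so that it can be mapped over lists of divisors
cofactor : ℕ → ℕ → ℕ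
cofactor n zero    = 0
cofactor n (suc d) = n / suc d

cofactor≡/ : ∀ n d .{{_ : NonZero d}} → cofactor n d ≡ n / d
cofactor≡/ n (suc d) = refl

GaussSum : Seq → ℕ → ℤ
GaussSum a n = sumℤ (map (λ k → μ (suc k) ℤ.* a (n / suc k)) (divisorsPred n))

A⁺≡prod : ∀ a n → A⁺ a n ≡ prodℤ (map (a ∘ cofactor n) (μ-divisors n 1ℤ))
A⁺≡prod a n = cong prodℤ (List.map-∘ (filter (λ k → μ (suc k) ℤ.≟ 1ℤ) (divisorsPred n)))

A⁻≡prod : ∀ a n → A⁻ a n ≡ prodℤ (map (a ∘ cofactor n) (μ-divisors n -1ℤ))
A⁻≡prod a n = cong prodℤ (List.map-∘ (filter (λ k → μ (suc k) ℤ.≟ -1ℤ) (divisorsPred n)))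

GaussSum≡sums : ∀ a n → GaussSum a n ≡
  sumℤ (map (a ∘ cofactor n) (μ-divisors n 1ℤ)) ℤ.- sumℤ (map (a ∘ cofactor n) (μ-divisors n -1ℤ))
GaussSum≡sums a n =
  trans (sumℤ-signed (μ ∘ suc) (λ k → a (n / suc k)) (μ-trichotomy ∘ suc) (divisorsPred n))
        (cong₂ ℤ._-_ (cong sumℤ (List.map-∘ (filter (λ k → μ (suc k) ℤ.≟ 1ℤ) (divisorsPred n))))
                     (cong sumℤ (List.map-∘ (filter (λ k → μ (suc k) ℤ.≟ -1ℤ) (divisorsPred n)))))

-- The Gauss sum modulo a prime power

module AtPrimePower (a : Seq) (seg : StrongEulerGauss a) {p : ℕ} (prime-p : Prime p) (j : ℕ) where

  private
    instance
      p≢0 : NonZero p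
      p≢0 = prime⇒nonZero prime-p

  q : ℕ
  q = p ^ suc j

  F G : ℕ → ℕ → ℤ
  F m d = a (cofactor (q * m) d)
  G m d = F m (p * d)

  F≡ : ∀ {m d} → d ∣ m → .{{_ : NonZero d}} → F m d ≡ a (q * (m / d))
  F≡ {m} {d} d∣m = cong a (trans (cofactor≡/ (q * m) d) (*-/-assoc q d∣m))

  G≡ : ∀ {m d} → d ∣ m → .{{_ : NonZero d}} → G m d ≡ a (p ^ j * (m / d))
  G≡ {m} {d} d∣m = cong a (begin
    cofactor (q * m) (p * d)     ≡⟨ cofactor≡/ (q * m) (p * d) ⟩
    (q * m) / (p * d)            ≡⟨ /-congˡ {o = p * d} (ℕ.*-assoc p (p ^ j) m) ⟩
    (p * (p ^ j * m)) / (p * d)  ≡⟨ m*n/m*o≡n/o p (p ^ j * m) d ⟩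
    (p ^ j * m) / d              ≡⟨ *-/-assoc (p ^ j) d∣m ⟩
    p ^ j * (m / d)              ∎)
    where
    open ≡-Reasoning
    instance
      p*d≢0 : NonZero (p * d)
      p*d≢0 = ℕ.m*n≢0 p d

  F≃G : ∀ {m d} → d ∣ m → .{{_ : NonZero d}} →
        a (q * (m / d)) ≃ a (p ^ j * (m / d)) ⟨mod q ⟩ → F m d ≃ G m d ⟨mod q ⟩
  F≃G d∣m = subst₂ (λ x y → x ≃ y ⟨mod q ⟩) (sym (F≡ d∣m)) (sym (G≡ d∣m))

  p∤cofactor : ∀ {m d} → ¬ p ∣ m → d ∣ m → .{{_ : NonZero d}} → ¬ p ∣ m / d
  p∤cofactor p∤m d∣m p∣m/d = p∤m (∣-trans p∣m/d (m/n∣m d∣m))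

  2≤q*m : ∀ {m} → ¬ p ∣ m → 2 ≤ q * m
  2≤q*m {m} p∤m = ℕ.≤-trans (prime⇒1< prime-p) (∣⇒≤ (∣-trans (m∣m*n (p ^ j)) (m∣m*n m)))
    where
    instance
      q*m≢0 : NonZero (q * m)
      q*m≢0 = ℕ.m*n≢0 q m {{ℕ.m^n≢0 p (suc j)}} {{∤⇒nonZero p∤m}}

  module _ {m ds} (p∤m : ¬ p ∣ m) (D₊≡1∷ds : μ-divisors m 1ℤ ≡ 1 ∷ ds) where

    private
      D₋ = μ-divisors m -1ℤ

    A⁺-factorisation : A⁺ a (q * m) ≡ F m 1 ℤ.* (prodℤ (map (F m) ds) ℤ.* prodℤ (map (G m) D₋))
    A⁺-factorisation = begin
      A⁺ a (q * m)
        ≡⟨ A⁺≡prod a (q * m) ⟩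
      prodℤ (map (F m) (μ-divisors (q * m) 1ℤ))
        ≡⟨ foldr-μ-divisors-split ℤ.*-1-isCommutativeMonoid {j = j} prime-p p∤m (λ ()) (F m) ⟩
      prodℤ (map (F m) (μ-divisors m 1ℤ)) ℤ.* prodℤ (map (G m) D₋)
        ≡⟨ cong (λ D₊ → prodℤ (map (F m) D₊) ℤ.* prodℤ (map (G m) D₋)) D₊≡1∷ds ⟩
      (F m 1 ℤ.* prodℤ (map (F m) ds)) ℤ.* prodℤ (map (G m) D₋)
        ≡⟨ ℤ.*-assoc (F m 1) _ _ ⟩
      F m 1 ℤ.* (prodℤ (map (F m) ds) ℤ.* prodℤ (map (G m) D₋))
        ∎
      where open ≡-Reasoning

    A⁻-factorisation : A⁻ a (q * m) ≡ G m 1 ℤ.* (prodℤ (map (G m) ds) ℤ.* prodℤ (map (F m) D₋))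
    A⁻-factorisation = begin
      A⁻ a (q * m)
        ≡⟨ A⁻≡prod a (q * m) ⟩
      prodℤ (map (F m) (μ-divisors (q * m) -1ℤ))
        ≡⟨ foldr-μ-divisors-split ℤ.*-1-isCommutativeMonoid {j = j} prime-p p∤m (λ ()) (F m) ⟩
      prodℤ (map (F m) D₋) ℤ.* prodℤ (map (G m) (μ-divisors m 1ℤ))
        ≡⟨ cong (λ D₊ → prodℤ (map (F m) D₋) ℤ.* prodℤ (map (G m) D₊)) D₊≡1∷ds ⟩
      prodℤ (map (F m) D₋) ℤ.* (G m 1 ℤ.* prodℤ (map (G m) ds))
        ≡⟨ lemma (prodℤ (map (F m) D₋)) (G m 1) (prodℤ (map (G m) ds)) ⟩
      G m 1 ℤ.* (prodℤ (map (G m) ds) ℤ.* prodℤ (map (F m) D₋))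
        ∎
      where
      open ≡-Reasoning
      lemma : ∀ x y z → x ℤ.* (y ℤ.* z) ≡ y ℤ.* (z ℤ.* x)
      lemma = solve-∀

  F≃G-at-1 : ∀ {m} → ¬ p ∣ m → (∀ {d} → d ∣ m → 1 < d → F m d ≃ G m d ⟨mod q ⟩) →
             F m 1 ≃ G m 1 ⟨mod q ⟩
  F≃G-at-1 {zero} p∤0 _ = contradiction (p ∣0) p∤0
  F≃G-at-1 {m@(suc m′)} p∤m F≃G-above-1 with μ-divisors-head m′
  ... | ds , D₊≡1∷ds = ≃-cancelʳ A⁺≃A⁻′ Z≃Z′ Z≢0
    where
    D₋ = μ-divisors m -1ℤ
    Z = prodℤ (map (F m) ds) ℤ.* prodℤ (map (G m) D₋)
    Z′ = prodℤ (map (G m) ds) ℤ.* prodℤ (map (F m) D₋)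
    1≤q*m : 1 ≤ q * m
    1≤q*m = ℕ.≤-trans (ℕ.s≤s ℕ.z≤n) (2≤q*m p∤m)
    A⁺≃A⁻′ : F m 1 ℤ.* Z ≃ G m 1 ℤ.* Z′ ⟨mod q ⟩
    A⁺≃A⁻′ = subst₂ (λ x y → x ≃ y ⟨mod q ⟩)
               (A⁺-factorisation p∤m D₊≡1∷ds) (A⁻-factorisation p∤m D₊≡1∷ds)
               (≃-∣ (m∣m*n m) (A⁺≃A⁻ a seg 1≤q*m))
    Z≢0 : Z ≢ 0ℤ
    Z≢0 Z≡0 = A⁺≢0 a seg 1≤q*m (2≤q*m p∤m)
      (trans (A⁺-factorisation p∤m D₊≡1∷ds) (trans (cong (F m 1 ℤ.*_) Z≡0) (ℤ.*-zeroʳ (F m 1))))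
    F≃G-≢1 : ∀ {s d} → d ∈ μ-divisors m s → 1 ≢ d → F m d ≃ G m d ⟨mod q ⟩
    F≃G-≢1 {s} d∈ 1≢d with ∈-μ-divisors⁻ m s d∈
    ... | d≢0 , d∣m , _ = F≃G-above-1 d∣m (ℕ.≤∧≢⇒< (ℕ.n≢0⇒n>0 (ℕ.≢-nonZero⁻¹ _ {{d≢0}})) 1≢d)
    1∉ds : All (1 ≢_) ds
    1∉ds with subst Unique D₊≡1∷ds (μ-divisors-unique m 1ℤ)
    ... | 1∉ds ∷ _ = 1∉ds
    1∉D₋ : ∀ {d} → d ∈ D₋ → 1 ≢ d
    1∉D₋ d∈D₋ refl with () ← proj₂ (proj₂ (∈-μ-divisors⁻ m -1ℤ d∈D₋))
    Z≃Z′ : Z ≃ Z′ ⟨mod q ⟩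
    Z≃Z′ = ≃-*
      (≃-product (F m) (G m) (All.tabulate λ {d} d∈ds →
         F≃G-≢1 (subst (d ∈_) (sym D₊≡1∷ds) (there d∈ds)) (All.lookup 1∉ds d∈ds)))
      (≃-sym (≃-product (F m) (G m) (All.tabulate λ d∈D₋ → F≃G-≢1 d∈D₋ (1∉D₋ d∈D₋))))

  a[q*m]≃a[p^j*m] : ∀ m → ¬ p ∣ m → a (q * m) ≃ a (p ^ j * m) ⟨mod q ⟩
  a[q*m]≃a[p^j*m] = <-rec _ step
    where
    step : ∀ m → (∀ {m′} → m′ < m → ¬ p ∣ m′ → a (q * m′) ≃ a (p ^ j * m′) ⟨mod q ⟩) →
           ¬ p ∣ m → a (q * m) ≃ a (p ^ j * m) ⟨mod q ⟩
    step m rec p∤m = subst (λ m → a (q * m) ≃ a (p ^ j * m) ⟨mod q ⟩) (n/1≡n m)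
      (subst₂ (λ x y → x ≃ y ⟨mod q ⟩) (F≡ (1∣ m)) (G≡ (1∣ m)) (F≃G-at-1 p∤m F≃G-above-1))
      where
      instance
        m≢0 : NonZero m
        m≢0 = ∤⇒nonZero p∤m
      F≃G-above-1 : ∀ {d} → d ∣ m → 1 < d → F m d ≃ G m d ⟨mod q ⟩
      F≃G-above-1 {d} d∣m 1<d = F≃G d∣m (rec (m/n<m m d 1<d) (p∤cofactor p∤m d∣m))
        where
        instance
          d≢0 : NonZero d
          d≢0 = ℕ.>-nonZero (ℕ.<-trans ℕ.z<s 1<d)

  GaussSum[q*m]≡0 : ∀ {m} → ¬ p ∣ m → GaussSum a (q * m) ≡ 0ℤ ⟨mod q ⟩
  GaussSum[q*m]≡0 {m} p∤m = begin
    GaussSum a (q * m)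
      ≡⟨ GaussSum≡sums a (q * m) ⟩
    Σ F (μ-divisors (q * m) 1ℤ) ℤ.- Σ F (μ-divisors (q * m) -1ℤ)
      ≡⟨ cong₂ ℤ._-_ (split 1ℤ (λ ())) (split -1ℤ (λ ())) ⟩
    (Σ F D₊ ℤ.+ Σ G D₋) ℤ.- (Σ F D₋ ℤ.+ Σ G D₊)
      ≈⟨ cross (ΣF≡ΣG 1ℤ) (ΣF≡ΣG -1ℤ) ⟩
    0ℤ
      ∎
    where
    open SetoidReasoning (≡⟨mod⟩-setoid q)
    Σ : (ℕ → ℕ → ℤ) → List ℕ → ℤ
    Σ f ds = sumℤ (map (f m) ds)
    split : ∀ s → s ≢ 0ℤ →
            Σ F (μ-divisors (q * m) s) ≡ Σ F (μ-divisors m s) ℤ.+ Σ G (μ-divisors m (- s))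
    split s s≢0 = foldr-μ-divisors-split ℤ.+-0-isCommutativeMonoid {j = j} prime-p p∤m s≢0 (F m)
    D₊ = μ-divisors m 1ℤ
    D₋ = μ-divisors m -1ℤ
    ΣF≡ΣG : ∀ s → Σ F (μ-divisors m s) ≡ Σ G (μ-divisors m s) ⟨mod q ⟩
    ΣF≡ΣG s = ≡⟨mod⟩-sum (F m) (G m) (All.tabulate λ d∈ → F≡G (∈-μ-divisors⁻ m s d∈))
      where
      F≡G : ∀ {d} → NonZero d × d ∣ m × μ d ≡ s → F m d ≡ G m d ⟨mod q ⟩
      F≡G {d} (d≢0 , d∣m , _) = ≃⇒≡⟨mod⟩ (F≃G d∣m (a[q*m]≃a[p^j*m] (m / d) (p∤cofactor p∤m d∣m)))
        where instance _ = d≢0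
    cross : ∀ {A A′ B B′} → A ≡ A′ ⟨mod q ⟩ → B ≡ B′ ⟨mod q ⟩ →
            (A ℤ.+ B′) ℤ.- (B ℤ.+ A′) ≡ 0ℤ ⟨mod q ⟩
    cross {A} {A′} {B} {B′} ⟨ q∣A-A′ ⟩ ⟨ q∣B-B′ ⟩ =
      ⟨ subst (_ ℤ.∣_) (lemma A A′ B B′) (ℤ.∣m∣n⇒∣m-n q∣A-A′ q∣B-B′) ⟩
      where
      lemma : ∀ A A′ B B′ → (A ℤ.- A′) ℤ.- (B ℤ.- B′) ≡ ((A ℤ.+ B′) ℤ.- (B ℤ.+ A′)) ℤ.- 0ℤ
      lemma = solve-∀

GaussSum≡0-mod-prime-power : ∀ a → StrongEulerGauss a → ∀ n → .{{_ : NonZero n}} → ∀ p k →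
                             Prime p → p ^ k ∣ n → GaussSum a n ≡ 0ℤ ⟨mod p ^ k ⟩
GaussSum≡0-mod-prime-power a seg n p k prime-p p^k∣n
  with J , m , n≡p^J*m , p∤m ← p-free-factorisation (prime⇒1< prime-p) n =
  ≡⟨mod⟩-∣ p^k∣p^J (GaussSum≡0-mod-p^ J n≡p^J*m)
  where
  p^k∣p^J : p ^ k ∣ p ^ J
  p^k∣p^J = coprime-divisor (coprime-^ {k = k} prime-p p∤m)
              (subst (p ^ k ∣_) (trans n≡p^J*m (ℕ.*-comm (p ^ J) m)) p^k∣n)
  GaussSum≡0-mod-p^ : ∀ J → n ≡ p ^ J * m → GaussSum a n ≡ 0ℤ ⟨mod p ^ J ⟩
  GaussSum≡0-mod-p^ zero    _         = ≡⟨mod1⟩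
  GaussSum≡0-mod-p^ (suc j) n≡p^[1+j]*m =
    subst (λ n → GaussSum a n ≡ 0ℤ ⟨mod p ^ suc j ⟩) (sym n≡p^[1+j]*m)
      (AtPrimePower.GaussSum[q*m]≡0 a seg prime-p j p∤m)

theorem2 : (a : Seq) → StrongEulerGauss a → Gauss a
theorem2 a seg n 1≤n = ∣-from-prime-powers n λ p k prime-p p^k∣n →
  toDefs (GaussSum≡0-mod-prime-power a seg n p k prime-p p^k∣n)
  where
  instance
    n≢0 : NonZero n
    n≢0 = ℕ.>-nonZero 1≤n
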